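{- For every integer $t\ge1$ let $I_{t,1}=[3t^2+1,3t^2+2t]$, $I_{t,2}=[3t^2+2t+1,3t^2+4t+1]$, $I_{t,3}=[3t^2+4t+2,3(t+1)^2]$ (intervals of integers), and set $E_{t,i}=\max\{\mathrm{c}(N):N\in I_{t,i},\ N\neq3k^2\text{ for all integers }k\}$ for $i\in\{1,2,3\}$. Then $E_{t,1}=6t+1$, $E_{t,2}=6t+3$ and $E_{t,3}=2t+1$.
   Context: For a positive integer $N$ not of the form $3k^2$, the extension coefficient is $\mathrm{c}(N)=\left\lfloor\frac{1}{\lceil\sqrt{3N}\rceil-\sqrt{3N}}\right\rfloor$. -}

module Defs where

open import Data.Nat using (ℕ; suc; _+_; _*_; _∸_; _≤_; _<_)
open import Data.Product using (Σ; _×_; ∃)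
open import Relation.Binary.PropositionalEquality using (_≢_)

-- N is not of the form 3k² (k an integer; k² ranges over squares of naturals)
NotThreeSquare : ℕ → Set
NotThreeSquare N = ∀ (k : ℕ) → N ≢ 3 * (k * k)

-- m = ⌈√(3N)⌉   (characterised by (m-1)² < 3N ≤ m², m ≥ 1)
IsCeilSqrt3 : ℕ → ℕ → Set
IsCeilSqrt3 N m = ((m ∸ 1) * (m ∸ 1) < 3 * N) × (3 * N ≤ m * m)

-- c = c(N) = ⌊ 1 / (m - √(3N)) ⌋ with m = ⌈√(3N)⌉, i.e.
--   c · (m - √(3N)) ≤ 1 < (c+1) · (m - √(3N)),
-- written with integers by squaring the nonnegative sides:
--   c·m - 1 ≤ c·√(3N)         ⇔ (c·m ∸ 1)² ≤ 3N·c²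
--   (c+1)·√(3N) < (c+1)·m - 1 ⇔ 3N·(c+1)² < ((c+1)·m ∸ 1)²
IsExtCoef : ℕ → ℕ → Set
IsExtCoef N c = Σ ℕ λ m → IsCeilSqrt3 N m
  × ((c * m ∸ 1) * (c * m ∸ 1) ≤ 3 * N * (c * c))
  × (3 * N * (suc c * suc c) < (suc c * m ∸ 1) * (suc c * m ∸ 1))

IsMaxExtCoef : ℕ → ℕ → ℕ → Set
IsMaxExtCoef lo hi E =
  (∀ N c → lo ≤ N → N ≤ hi → NotThreeSquare N → IsExtCoef N c → c ≤ E)
  × (∃ λ N → lo ≤ N × N ≤ hi × NotThreeSquare N × IsExtCoef N E)

-- With m = ⌈√(3N)⌉ and deficiency d = m² − 3N, squaring out the defining
-- inequalities of c(N) shows that c · d < 2m ≤ (c + 1) · d, i.e.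
-- c(N) = ⌊(2m − 1)/d⌋.  On I_{t,1} and I_{t,2} the ceiling is 3t + 1 resp. 3t + 2
-- and d ≥ 1, while on I_{t,3} it is 3t + 3 and d ≥ 3, because 3N ≤ 9(t+1)² − 3
-- once N ≠ 3(t+1)².  The bounds 6t + 1, 6t + 3, 2t + 1 follow, and they are
-- attained at the right end of each interval (at 3(t+1)² − 1 for I_{t,3}),
-- where d is exactly 1, 1, 3.
module Submission where

open import Defs
open import Data.Nat using (ℕ; zero; suc; _+_; _*_; _∸_; _≤_; _<_; z≤n; s≤s; _≤?_; NonZero)
open import Data.Nat.Properties
open import Data.Nat.Tactic.RingSolver using (solve-∀)
open import Data.Product using (_×_; _,_; ∃)
open import Algebra.Definitions.RawMagma using (_,_)
open import Relation.Nullary using (yes; no; contradiction)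
open import Relation.Binary using (tri<; tri≈; tri>)
open import Relation.Binary.PropositionalEquality

⌈√⌉-unique : ∀ {X m} a → (m ∸ 1) * (m ∸ 1) < X → X ≤ m * m →
             a * a < X → X ≤ suc a * suc a → m ≡ suc a
⌈√⌉-unique {X} {m} a m-1²<X X≤m² a²<X X≤sa² with <-cmp m (suc a)
... | tri≈ _ m≡sa _ = m≡sa
... | tri< (s≤s m≤a) _ _ =
  contradiction (<-≤-trans a²<X (≤-trans X≤m² (*-mono-≤ m≤a m≤a))) (n≮n _)
... | tri> _ _ sa<m =
  contradiction (<-≤-trans m-1²<X (≤-trans X≤sa² (*-mono-≤ sa≤m-1 sa≤m-1))) (n≮n _)
  where
  sa≤m-1 : suc a ≤ m ∸ 1
  sa≤m-1 = ∸-monoˡ-≤ 1 sa<m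

NotThreeSquare-between : ∀ t {N} → 3 * (t * t) < N → N < 3 * (suc t * suc t) →
                         NotThreeSquare N
NotThreeSquare-between t {N} 3t²<N N<3[t+1]² k N≡3k² with k ≤? t
... | yes k≤t = contradiction (≤-trans 3t²<N (≤-trans (≤-reflexive N≡3k²)
                  (*-monoʳ-≤ 3 (*-mono-≤ k≤t k≤t)))) (n≮n _)
... | no k≰t = contradiction (≤-trans N<3[t+1]² (≤-trans (*-monoʳ-≤ 3 (*-mono-≤ t<k t<k))
                  (≤-reflexive (sym N≡3k²)))) (n≮n _)
  where
  t<k : suc t ≤ k
  t<k = ≰⇒> k≰t

suc-square : ∀ k → 1 ≤ k → suc (k * k) ≡ (k ∸ 1) * (k ∸ 1) + 2 * k
suc-square (suc j) _ = identity j
  where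
  identity : ∀ j → suc (suc j * suc j) ≡ j * j + 2 * suc j
  identity = solve-∀

m*m*[n*n]≡n*m*[n*m] : ∀ m n → m * m * (n * n) ≡ n * m * (n * m)
m*m*[n*n]≡n*m*[n*m] = solve-∀

m*[m*n]≡n*[m*m] : ∀ m n → m * (m * n) ≡ n * (m * m)
m*[m*n]≡n*[m*m] = solve-∀

m*[2*n]≡2*[m*n] : ∀ m n → m * (2 * n) ≡ 2 * (m * n)
m*[2*n]≡2*[m*n] = solve-∀

scale-gap< : ∀ c d m .{{_ : NonZero c}} → c * d < 2 * m → d * (c * c) < 2 * (c * m)
scale-gap< c d m gap = subst₂ _<_ (m*[m*n]≡n*[m*m] c d) (m*[2*n]≡2*[m*n] c m) (*-monoʳ-< c gap)

unscale-gap< : ∀ c d m → d * (c * c) < 2 * (c * m) → c * d < 2 * m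
unscale-gap< c d m gap = *-cancelˡ-< c _ _
  (subst₂ _<_ (sym (m*[m*n]≡n*[m*m] c d)) (sym (m*[2*n]≡2*[m*n] c m)) gap)

scale-gap≤ : ∀ c d m → 2 * m ≤ c * d → 2 * (c * m) ≤ d * (c * c)
scale-gap≤ c d m gap = subst₂ _≤_ (m*[2*n]≡2*[m*n] c m) (m*[m*n]≡n*[m*m] c d) (*-monoʳ-≤ c gap)

1≤m*n : ∀ m n → 1 ≤ m → 1 ≤ n → 1 ≤ m * n
1≤m*n _ _ 1≤m 1≤n = *-mono-≤ 1≤m 1≤n

-- With X + d = m² and k = c · m, both squared conditions compare c²X against
-- (k − 1)² = k² + 1 − 2k = c²X + c²d + 1 − 2k, so they reduce to comparing
-- c²d with 2k = c · 2m.
lower-condition⇒gap : ∀ {X d m} c → 1 ≤ m → X + d ≤ m * m →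
                      (c * m ∸ 1) * (c * m ∸ 1) ≤ X * (c * c) → c * d < 2 * m
lower-condition⇒gap zero 1≤m _ _ = ≤-trans 1≤m (m≤m+n _ _)
lower-condition⇒gap {X} {d} {m} c@(suc _) 1≤m X+d≤m² low =
  unscale-gap< c d m (+-cancelˡ-≤ P _ _ chain)
  where
  k = c * m
  P = (k ∸ 1) * (k ∸ 1)
  chain : P + suc (d * (c * c)) ≤ P + 2 * k
  chain = begin
    P + suc (d * (c * c))               ≤⟨ +-monoˡ-≤ _ low ⟩
    X * (c * c) + suc (d * (c * c))     ≡⟨ +-suc _ _ ⟩
    suc (X * (c * c) + d * (c * c))     ≡⟨ cong suc (*-distribʳ-+ (c * c) X d) ⟨
    suc ((X + d) * (c * c))             ≤⟨ s≤s (*-monoˡ-≤ (c * c) X+d≤m²) ⟩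
    suc (m * m * (c * c))               ≡⟨ cong suc (m*m*[n*n]≡n*m*[n*m] m c) ⟩
    suc (k * k)                         ≡⟨ suc-square k (1≤m*n c m (s≤s z≤n) 1≤m) ⟩
    P + 2 * k                           ∎
    where open ≤-Reasoning

gap⇒lower-condition : ∀ {X d m} c → 1 ≤ m → X + d ≡ m * m → c * d < 2 * m →
                      (c * m ∸ 1) * (c * m ∸ 1) ≤ X * (c * c)
gap⇒lower-condition zero _ _ _ = z≤n
gap⇒lower-condition {X} {d} {m} c@(suc _) 1≤m X+d≡m² gap =
  +-cancelʳ-≤ (suc (d * (c * c))) P (X * (c * c)) chain
  where
  k = c * m
  P = (k ∸ 1) * (k ∸ 1)
  chain : P + suc (d * (c * c)) ≤ X * (c * c) + suc (d * (c * c))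
  chain = begin
    P + suc (d * (c * c))               ≤⟨ +-monoʳ-≤ P (scale-gap< c d m gap) ⟩
    P + 2 * k                           ≡⟨ suc-square k (1≤m*n c m (s≤s z≤n) 1≤m) ⟨
    suc (k * k)                         ≡⟨ cong suc (m*m*[n*n]≡n*m*[n*m] m c) ⟨
    suc (m * m * (c * c))               ≡⟨ cong (λ x → suc (x * (c * c))) X+d≡m² ⟨
    suc ((X + d) * (c * c))             ≡⟨ cong suc (*-distribʳ-+ (c * c) X d) ⟩
    suc (X * (c * c) + d * (c * c))     ≡⟨ +-suc _ _ ⟨
    X * (c * c) + suc (d * (c * c))     ∎
    where open ≤-Reasoning

gap⇒upper-condition : ∀ {X d m} c → 1 ≤ m → X + d ≡ m * m → 2 * m ≤ suc c * d →
                      X * (suc c * suc c) < (suc c * m ∸ 1) * (suc c * m ∸ 1)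
gap⇒upper-condition {X} {d} {m} c 1≤m X+d≡m² gap =
  +-cancelʳ-≤ (d * (s * s)) (suc (X * (s * s))) P chain
  where
  s = suc c
  k = s * m
  P = (k ∸ 1) * (k ∸ 1)
  chain : suc (X * (s * s)) + d * (s * s) ≤ P + d * (s * s)
  chain = begin
    suc (X * (s * s) + d * (s * s))     ≡⟨ cong suc (*-distribʳ-+ (s * s) X d) ⟨
    suc ((X + d) * (s * s))             ≡⟨ cong (λ x → suc (x * (s * s))) X+d≡m² ⟩
    suc (m * m * (s * s))               ≡⟨ cong suc (m*m*[n*n]≡n*m*[n*m] m s) ⟩
    suc (k * k)                         ≡⟨ suc-square k (1≤m*n s m (s≤s z≤n) 1≤m) ⟩
    P + 2 * k                           ≤⟨ +-monoʳ-≤ P (scale-gap≤ s d m gap) ⟩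
    P + d * (s * s)                     ∎
    where open ≤-Reasoning

IsExtCoef⇒gap : ∀ {N c d} a → IsExtCoef N c → a * a < 3 * N →
                3 * N + d ≤ suc a * suc a → c * d < 2 * suc a
IsExtCoef⇒gap {N} {c} a (m , (m-1²<3N , 3N≤m²) , low , _) a²<3N 3N+d≤sa²
  with ⌈√⌉-unique {m = m} a m-1²<3N 3N≤m² a²<3N (≤-trans (m≤m+n _ _) 3N+d≤sa²)
... | refl = lower-condition⇒gap c (s≤s z≤n) 3N+d≤sa² low

IsExtCoef-intro : ∀ {N d} c a → a * a < 3 * N → 3 * N + d ≡ suc a * suc a →
                  c * d < 2 * suc a → 2 * suc a ≤ suc c * d → IsExtCoef N c
IsExtCoef-intro {N} {d} c a a²<3N 3N+d≡sa² gap< gap≥ =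
  suc a , (a²<3N , ≤″⇒≤ (d , 3N+d≡sa²))
        , gap⇒lower-condition c (s≤s z≤n) 3N+d≡sa² gap<
        , gap⇒upper-condition c (s≤s z≤n) 3N+d≡sa² gap≥

IsMaxExtCoef-intro : ∀ {lo hi E} a d →
  (∀ {N} → lo ≤ N → N ≤ hi → NotThreeSquare N → a * a < 3 * N × 3 * N + d ≤ suc a * suc a) →
  (∀ {c} → c * d < 2 * suc a → c ≤ E) →
  ∃ (λ N → lo ≤ N × N ≤ hi × NotThreeSquare N × IsExtCoef N E) →
  IsMaxExtCoef lo hi E
IsMaxExtCoef-intro {lo} {hi} {E} a d ceiling gap⇒≤E witness = bounded , witness
  where
  bounded : ∀ N c → lo ≤ N → N ≤ hi → NotThreeSquare N → IsExtCoef N c → c ≤ E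
  bounded N c lo≤N N≤hi N≢3k² ext with ceiling lo≤N N≤hi N≢3k²
  ... | a²<3N , 3N+d≤sa² = gap⇒≤E (IsExtCoef⇒gap {N} {c} {d} a ext a²<3N 3N+d≤sa²)

interval₁ : ∀ t → 1 ≤ t →
            IsMaxExtCoef (3 * (t * t) + 1) (3 * (t * t) + 2 * t) (6 * t + 1)
interval₁ t@(suc u) _ = IsMaxExtCoef-intro (3 * t) 1 ceiling gap⇒≤E
  ( N₀ , ≤″⇒≤ (2 * u + 1 , lo+ u) , ≤-refl
  , NotThreeSquare-between t (≤″⇒≤ (2 * u + 1 , sq+ u)) (≤″⇒≤ (4 * t + 2 , sq- t))
  , IsExtCoef-intro {N₀} (6 * t + 1) (3 * t) (≤″⇒≤ (6 * u + 5 , a²< u)) (3N+1 t)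
      (≤-reflexive (sym (gap t))) (≤-reflexive (gap t)) )
  where
  N₀ = 3 * (t * t) + 2 * t
  sq+ : ∀ u → suc (3 * (suc u * suc u)) + (2 * u + 1) ≡ 3 * (suc u * suc u) + 2 * suc u
  sq+ = solve-∀
  lo+ : ∀ u → 3 * (suc u * suc u) + 1 + (2 * u + 1) ≡ 3 * (suc u * suc u) + 2 * suc u
  lo+ = solve-∀
  sq- : ∀ t → suc (3 * (t * t) + 2 * t) + (4 * t + 2) ≡ 3 * (suc t * suc t)
  sq- = solve-∀
  a²< : ∀ u → suc (3 * suc u * (3 * suc u)) + (6 * u + 5) ≡ 3 * (3 * (suc u * suc u) + 2 * suc u)
  a²< = solve-∀
  3N+1 : ∀ t → 3 * (3 * (t * t) + 2 * t) + 1 ≡ suc (3 * t) * suc (3 * t)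
  3N+1 = solve-∀
  gap : ∀ t → 2 * suc (3 * t) ≡ suc (6 * t + 1) * 1
  gap = solve-∀
  3lo : ∀ t → suc (3 * t * (3 * t)) + 2 ≡ 3 * (3 * (t * t) + 1)
  3lo = solve-∀
  ceiling : ∀ {N} → 3 * (t * t) + 1 ≤ N → N ≤ N₀ → NotThreeSquare N →
            3 * t * (3 * t) < 3 * N × 3 * N + 1 ≤ suc (3 * t) * suc (3 * t)
  ceiling lo≤N N≤N₀ _ = ≤-trans (≤″⇒≤ (2 , 3lo t)) (*-monoʳ-≤ 3 lo≤N)
                      , ≤-trans (+-monoˡ-≤ 1 (*-monoʳ-≤ 3 N≤N₀)) (≤-reflexive (3N+1 t))
  gap⇒≤E : ∀ {c} → c * 1 < 2 * suc (3 * t) → c ≤ 6 * t + 1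
  gap⇒≤E {c} c<2m = ≤-pred (subst₂ _<_ (*-identityʳ c) (trans (gap t) (*-identityʳ _)) c<2m)

interval₂ : ∀ t →
            IsMaxExtCoef (3 * (t * t) + 2 * t + 1) (3 * (t * t) + 4 * t + 1) (6 * t + 3)
interval₂ t = IsMaxExtCoef-intro (3 * t + 1) 1 ceiling gap⇒≤E
  ( N₀ , ≤″⇒≤ (2 * t , lo+ t) , ≤-refl
  , NotThreeSquare-between t (≤″⇒≤ (4 * t , sq+ t)) (≤″⇒≤ (2 * t + 1 , sq- t))
  , IsExtCoef-intro {N₀} (6 * t + 3) (3 * t + 1) (≤″⇒≤ (6 * t + 1 , a²< t)) (3N+1 t)
      (≤-reflexive (sym (gap t))) (≤-reflexive (gap t)) )
  where
  N₀ = 3 * (t * t) + 4 * t + 1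
  lo+ : ∀ t → 3 * (t * t) + 2 * t + 1 + 2 * t ≡ 3 * (t * t) + 4 * t + 1
  lo+ = solve-∀
  sq+ : ∀ t → suc (3 * (t * t)) + 4 * t ≡ 3 * (t * t) + 4 * t + 1
  sq+ = solve-∀
  sq- : ∀ t → suc (3 * (t * t) + 4 * t + 1) + (2 * t + 1) ≡ 3 * (suc t * suc t)
  sq- = solve-∀
  a²< : ∀ t → suc ((3 * t + 1) * (3 * t + 1)) + (6 * t + 1) ≡ 3 * (3 * (t * t) + 4 * t + 1)
  a²< = solve-∀
  3N+1 : ∀ t → 3 * (3 * (t * t) + 4 * t + 1) + 1 ≡ suc (3 * t + 1) * suc (3 * t + 1)
  3N+1 = solve-∀
  gap : ∀ t → 2 * suc (3 * t + 1) ≡ suc (6 * t + 3) * 1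
  gap = solve-∀
  3lo : ∀ t → suc ((3 * t + 1) * (3 * t + 1)) + 1 ≡ 3 * (3 * (t * t) + 2 * t + 1)
  3lo = solve-∀
  ceiling : ∀ {N} → 3 * (t * t) + 2 * t + 1 ≤ N → N ≤ N₀ → NotThreeSquare N →
            (3 * t + 1) * (3 * t + 1) < 3 * N × 3 * N + 1 ≤ suc (3 * t + 1) * suc (3 * t + 1)
  ceiling lo≤N N≤N₀ _ = ≤-trans (≤″⇒≤ (1 , 3lo t)) (*-monoʳ-≤ 3 lo≤N)
                      , ≤-trans (+-monoˡ-≤ 1 (*-monoʳ-≤ 3 N≤N₀)) (≤-reflexive (3N+1 t))
  gap⇒≤E : ∀ {c} → c * 1 < 2 * suc (3 * t + 1) → c ≤ 6 * t + 3
  gap⇒≤E {c} c<2m = ≤-pred (subst₂ _<_ (*-identityʳ c) (trans (gap t) (*-identityʳ _)) c<2m)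

interval₃ : ∀ t →
            IsMaxExtCoef (3 * (t * t) + 4 * t + 2) (3 * ((t + 1) * (t + 1))) (2 * t + 1)
interval₃ t = IsMaxExtCoef-intro (3 * t + 2) 3 ceiling gap⇒≤E
  ( N₀ , ≤″⇒≤ (2 * t , lo+ t) , ≤″⇒≤ (1 , hi- t)
  , NotThreeSquare-between t (≤″⇒≤ (6 * t + 1 , sq+ t)) (≤-reflexive (sq- t))
  , IsExtCoef-intro {N₀} (2 * t + 1) (3 * t + 2) (≤″⇒≤ (6 * t + 1 , a²< t)) (3N+3 t)
      (≤″⇒≤ (2 , gap< t)) (≤-reflexive (gap t)) )
  where
  N₀ = 3 * (t * t) + 6 * t + 2
  lo+ : ∀ t → 3 * (t * t) + 4 * t + 2 + 2 * t ≡ 3 * (t * t) + 6 * t + 2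
  lo+ = solve-∀
  hi- : ∀ t → 3 * (t * t) + 6 * t + 2 + 1 ≡ 3 * ((t + 1) * (t + 1))
  hi- = solve-∀
  sq+ : ∀ t → suc (3 * (t * t)) + (6 * t + 1) ≡ 3 * (t * t) + 6 * t + 2
  sq+ = solve-∀
  sq- : ∀ t → suc (3 * (t * t) + 6 * t + 2) ≡ 3 * (suc t * suc t)
  sq- = solve-∀
  a²< : ∀ t → suc ((3 * t + 2) * (3 * t + 2)) + (6 * t + 1) ≡ 3 * (3 * (t * t) + 6 * t + 2)
  a²< = solve-∀
  3N+3 : ∀ t → 3 * (3 * (t * t) + 6 * t + 2) + 3 ≡ suc (3 * t + 2) * suc (3 * t + 2)
  3N+3 = solve-∀
  gap< : ∀ t → suc ((2 * t + 1) * 3) + 2 ≡ 2 * suc (3 * t + 2)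
  gap< = solve-∀
  gap : ∀ t → 2 * suc (3 * t + 2) ≡ suc (2 * t + 1) * 3
  gap = solve-∀
  3lo : ∀ t → suc ((3 * t + 2) * (3 * t + 2)) + 1 ≡ 3 * (3 * (t * t) + 4 * t + 2)
  3lo = solve-∀
  3suc : ∀ N → 3 * suc N ≡ 3 * N + 3
  3suc = solve-∀
  3hi : ∀ t → 3 * (3 * ((t + 1) * (t + 1))) ≡ suc (3 * t + 2) * suc (3 * t + 2)
  3hi = solve-∀
  ceiling : ∀ {N} → 3 * (t * t) + 4 * t + 2 ≤ N → N ≤ 3 * ((t + 1) * (t + 1)) →
            NotThreeSquare N →
            (3 * t + 2) * (3 * t + 2) < 3 * N × 3 * N + 3 ≤ suc (3 * t + 2) * suc (3 * t + 2)
  ceiling {N} lo≤N N≤hi N≢3k² =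
      ≤-trans (≤″⇒≤ (1 , 3lo t)) (*-monoʳ-≤ 3 lo≤N)
    , subst₂ _≤_ (3suc N) (3hi t) (*-monoʳ-≤ 3 (≤∧≢⇒< N≤hi (N≢3k² (t + 1))))
  gap⇒≤E : ∀ {c} → c * 3 < 2 * suc (3 * t + 2) → c ≤ 2 * t + 1
  gap⇒≤E {c} c<2m = ≤-pred (*-cancelʳ-< 3 c (suc (2 * t + 1)) (subst (c * 3 <_) (gap t) c<2m))

proposition3 : ∀ (t : ℕ) → 1 ≤ t →
    IsMaxExtCoef (3 * (t * t) + 1) (3 * (t * t) + 2 * t) (6 * t + 1)
    × IsMaxExtCoef (3 * (t * t) + 2 * t + 1) (3 * (t * t) + 4 * t + 1) (6 * t + 3)
    × IsMaxExtCoef (3 * (t * t) + 4 * t + 2) (3 * ((t + 1) * (t + 1))) (2 * t + 1)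
proposition3 t 1≤t = interval₁ t 1≤t , interval₂ t , interval₃ t
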